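{- The integers $c_p(\tau)$ and $w_p(\tau)$ depend only on the double coset $K_0(p^{n_p})\tau N({\mathbb Z}_p)$. Moreover, the double coset $K_0(p^{n_p})\tau N({\mathbb Z}_p)$ contains the matrix $\begin{pmatrix} 1&0\\ p^{c_p(\tau)}&v\end{pmatrix}$ for some $v \in {\mathbb Z}_p^\times$.
   Context: Let $N=\prod_p p^{n_p}$ be a positive integer and $p$ a prime. Let $K_0(p^{n_p}) = \operatorname{GL}_2({\mathbb Z}_p) \cap \begin{pmatrix} {\mathbb Z}_p & {\mathbb Z}_p \\ p^{n_p}{\mathbb Z}_p & {\mathbb Z}_p \end{pmatrix}$ and $N({\mathbb Z}_p)=\{\begin{pmatrix}1&x\\ 0&1\end{pmatrix}: x\in{\mathbb Z}_p\}$. For $\tau = \begin{pmatrix} a & b \\ c & d\end{pmatrix} \in \operatorname{GL}_2({\mathbb Z}_p)$ define $c_p(\tau) = \min(v_p(c), n_p)$ and $w_p(\tau) = \max(n_p - 2c_p(\tau), 0)$. -}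

module Defs where

open import Data.Nat using (ℕ; zero; suc; _+_; _*_; _∸_; _^_; _<_; NonZero)
open import Data.Nat.Properties using (m^n≢0; *-assoc)
open import Data.Nat.DivMod using (_%_; _/_; m%n<n; m≡m%n+[m/n]*n; [m+kn]%n≡m%n; %-distribˡ-+; %-distribˡ-*)
open import Data.Product using (Σ; ∃; _×_; _,_)
open import Relation.Binary.PropositionalEquality using (_≡_; refl; sym; trans; cong; cong₂)
open import Relation.Nullary using (yes; no)
open import Data.Nat using (_≟_)

-- The p-adic integers ℤₚ, modelled as the inverse limit lim ℤ/pᵏℤ:
-- an element is a sequence of canonical residues  seq k ∈ [0, pᵏ)
-- which is compatible under the reduction maps ℤ/pᵏ⁺¹ → ℤ/pᵏ.
-- Two elements are equal iff their sequences agree pointwise (_≈ₚ_).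

module _ (p : ℕ) {{_ : NonZero p}} where

  _%ᵖ_ : ℕ → ℕ → ℕ
  m %ᵖ k = _%_ m (p ^ k) {{m^n≢0 p k}}
  infixl 7 _%ᵖ_

  record ℤₚ : Set where
    field
      seq    : ℕ → ℕ
      bound  : ∀ k → seq k < p ^ k
      compat : ∀ k → seq (suc k) %ᵖ k ≡ seq k
  open ℤₚ public

  private
    modmod : ∀ m k → m %ᵖ suc k %ᵖ k ≡ m %ᵖ k
    modmod m k = sym (trans (cong (_%ᵖ k) (m≡m%n+[m/n]*n m (p ^ suc k) {{m^n≢0 p (suc k)}}))
      (trans (cong (λ t → (m %ᵖ suc k + t) %ᵖ k) (sym (*-assoc (_/_ m (p ^ suc k) {{m^n≢0 p (suc k)}}) p (p ^ k))))
             ([m+kn]%n≡m%n (m %ᵖ suc k) (_/_ m (p ^ suc k) {{m^n≢0 p (suc k)}} * p) (p ^ k) {{m^n≢0 p k}})))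

  _≈ₚ_ : ℤₚ → ℤₚ → Set
  x ≈ₚ y = ∀ k → seq x k ≡ seq y k

  fromℕₚ : ℕ → ℤₚ
  fromℕₚ n = record
    { seq = λ k → n %ᵖ k
    ; bound = λ k → m%n<n n (p ^ k) {{m^n≢0 p k}}
    ; compat = λ k → modmod n k }

  0ₚ 1ₚ : ℤₚ
  0ₚ = fromℕₚ 0
  1ₚ = fromℕₚ 1

  _+ₚ_ : ℤₚ → ℤₚ → ℤₚ
  x +ₚ y = record
    { seq = λ k → (seq x k + seq y k) %ᵖ k
    ; bound = λ k → m%n<n (seq x k + seq y k) (p ^ k) {{m^n≢0 p k}}
    ; compat = λ k → trans (modmod (seq x (suc k) + seq y (suc k)) k)
        (trans (%-distribˡ-+ (seq x (suc k)) (seq y (suc k)) (p ^ k) {{m^n≢0 p k}})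
               (cong₂ (λ a b → (a + b) %ᵖ k) (compat x k) (compat y k))) }

  _*ₚ_ : ℤₚ → ℤₚ → ℤₚ
  x *ₚ y = record
    { seq = λ k → (seq x k * seq y k) %ᵖ k
    ; bound = λ k → m%n<n (seq x k * seq y k) (p ^ k) {{m^n≢0 p k}}
    ; compat = λ k → trans (modmod (seq x (suc k) * seq y (suc k)) k)
        (trans (%-distribˡ-* (seq x (suc k)) (seq y (suc k)) (p ^ k) {{m^n≢0 p k}})
               (cong₂ (λ a b → (a * b) %ᵖ k) (compat x k) (compat y k))) }

  IsUnitₚ : ℤₚ → Set
  IsUnitₚ u = Σ ℤₚ (λ u' → (u *ₚ u') ≈ₚ 1ₚ)

  -- min(v_p(c), n): the largest k ≤ n with pᵏ ∣ c, i.e. with c ≡ 0 mod pᵏ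
  -- (c ∈ pᵏℤₚ  iff  the level-k residue of c is 0).
  minVal : ℕ → ℤₚ → ℕ
  minVal zero    c = zero
  minVal (suc n) c with seq c (suc n) ≟ 0
  ... | yes _ = suc n
  ... | no  _ = minVal n c

  record M2 : Set where
    constructor mat
    field
      a b c d : ℤₚ
  open M2 public

  _≈M_ : M2 → M2 → Set
  x ≈M y = (a x ≈ₚ a y) × (b x ≈ₚ b y) × (c x ≈ₚ c y) × (d x ≈ₚ d y)

  _·_ : M2 → M2 → M2
  x · y = mat ((a x *ₚ a y) +ₚ (b x *ₚ c y)) ((a x *ₚ b y) +ₚ (b x *ₚ d y))
              ((c x *ₚ a y) +ₚ (d x *ₚ c y)) ((c x *ₚ b y) +ₚ (d x *ₚ d y))

  I₂ : M2
  I₂ = mat 1ₚ 0ₚ 0ₚ 1ₚ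

  IsGL2 : M2 → Set
  IsGL2 g = Σ M2 (λ h → ((g · h) ≈M I₂) × ((h · g) ≈M I₂))

  InK0 : ℕ → M2 → Set
  InK0 n g = IsGL2 g × Σ ℤₚ (λ y → c g ≈ₚ (fromℕₚ (p ^ n) *ₚ y))

  nmat : ℤₚ → M2
  nmat x = mat 1ₚ x 0ₚ 1ₚ

  InDoubleCoset : ℕ → M2 → M2 → Set
  InDoubleCoset n τ σ = Σ M2 (λ k → InK0 n k × Σ ℤₚ (λ x → σ ≈M ((k · τ) · nmat x)))

  -- c_p(τ) = min(v_p(c), n_p) and w_p(τ) = max(n_p − 2 c_p(τ), 0)
  cₚ : ℕ → M2 → ℕ
  cₚ n τ = minVal n (c τ)

  wₚ : ℕ → M2 → ℕ
  wₚ n τ = n ∸ 2 * cₚ n τ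

module Submission where

-- Congruence modulo pᵏ, i.e. equality of k-th residues, is a ring congruence on ℤₚ, and c_p(τ) is the
-- largest k ≤ n with c(τ) ≡ 0 (mod pᵏ).
--
-- Invariance: if τ′ = κ τ n(x) with κ ∈ K₀(pⁿ), then modulo pᵏ (k ≤ n) the lower-left entry of κ
-- vanishes, so c(τ′) ≡ d(κ) c(τ) where d(κ) is a unit; hence c(τ′) and c(τ) vanish modulo the same pᵏ.
--
-- Representative: for σ = [[1, 0], [pᵐ, v]] (m = c_p(τ)) put κ = σ n(x) τ⁻¹, so that σ = κ τ n(−x).
-- The lower-left entry of κ is the row (pᵐ, pᵐx + v) applied to the first column of τ⁻¹, which is a
-- multiple of (d, −c); so κ ∈ K₀(pⁿ) as soon as c (pᵐx + v) ≡ d pᵐ (mod pⁿ). If m = n, v = 1 and x = 0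
-- work. Otherwise c = pᵐ y with y a unit, and t = d y⁻¹ satisfies c t = d pᵐ: take v = t, x = 0 when
-- m ≥ 1 (then p ∣ c, which forces d to be a unit), and v = 1, x = t − 1 when m = 0.

open import Algebra.Bundles using (CommutativeRing; Monoid)
open import Data.Product using (Σ; _×_; _,_; proj₁; proj₂)
open import Function.Bundles using (_⇔_; mk⇔; Equivalence)
open import Level using (0ℓ; _⊔_)

module CommutativeRingProperties {c ℓ} (R : CommutativeRing c ℓ) where
  open CommutativeRing R
  open import Algebra.Properties.CommutativeSemigroup *-commutativeSemigroup using (interchange; xy∙z≈xz∙y; xy∙z≈y∙xz)
  open import Algebra.Properties.Group +-group using (identityˡ-unique; inverseʳ-unique)
  open import Algebra.Properties.Ring ring using (-‿distribʳ-*; -‿involutive)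
  open import Algebra.Solver.Ring.NaturalCoefficients.Default commutativeSemiring using (solve; _:+_; _:*_; _:=_; con)
  open import Relation.Binary.Reasoning.Setoid setoid

  IsUnit : Carrier → Set (c ⊔ ℓ)
  IsUnit u = Σ Carrier (λ w → u * w ≈ 1#)

  *-isUnit : ∀ u v → IsUnit u → IsUnit v → IsUnit (u * v)
  *-isUnit u v (u′ , uu′≈1) (v′ , vv′≈1) = u′ * v′ , (begin
    u * v * (u′ * v′)  ≈⟨ interchange u v u′ v′ ⟩
    u * u′ * (v * v′)  ≈⟨ *-cong uu′≈1 vv′≈1 ⟩
    1# * 1#            ≈⟨ *-identityˡ 1# ⟩
    1#                 ∎)

  inverse-unique : ∀ u v w → u * v ≈ 1# → u * w ≈ 1# → v ≈ w
  inverse-unique u v w uv≈1 uw≈1 = begin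
    v          ≈⟨ *-identityˡ v ⟨
    1# * v     ≈⟨ *-congʳ uw≈1 ⟨
    u * w * v  ≈⟨ xy∙z≈xz∙y u w v ⟩
    u * v * w  ≈⟨ *-congʳ uv≈1 ⟩
    1# * w     ≈⟨ *-identityˡ w ⟩
    w          ∎

  isUnit*x≈0⇒x≈0 : ∀ u x → IsUnit u → u * x ≈ 0# → x ≈ 0#
  isUnit*x≈0⇒x≈0 u x (w , uw≈1) ux≈0 = begin
    x            ≈⟨ *-identityˡ x ⟨
    1# * x       ≈⟨ *-congʳ uw≈1 ⟨
    u * w * x    ≈⟨ xy∙z≈y∙xz u w x ⟩
    w * (u * x)  ≈⟨ *-congˡ ux≈0 ⟩
    w * 0#       ≈⟨ zeroʳ w ⟩
    0#           ∎

  1+x*u≈0⇒u*-x≈1 : ∀ x u → 1# + x * u ≈ 0# → u * - x ≈ 1#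
  1+x*u≈0⇒u*-x≈1 x u 1+xu≈0 = begin
    u * - x    ≈⟨ -‿distribʳ-* u x ⟨
    - (u * x)  ≈⟨ -‿cong (*-comm u x) ⟩
    - (x * u)  ≈⟨ -‿cong (inverseʳ-unique 1# (x * u) 1+xu≈0) ⟩
    - (- 1#)   ≈⟨ -‿involutive 1# ⟩
    1#         ∎

  1*x+0*y≈x : ∀ x y → 1# * x + 0# * y ≈ x
  1*x+0*y≈x = solve 2 (λ x y → con 1 :* x :+ con 0 :* y := x) refl

  0*x+1*y≈y : ∀ x y → 0# * x + 1# * y ≈ y
  0*x+1*y≈y = solve 2 (λ x y → con 0 :* x :+ con 1 :* y := y) refl

  x*1+y*0≈x : ∀ x y → x * 1# + y * 0# ≈ x
  x*1+y*0≈x = solve 2 (λ x y → x :* con 1 :+ y :* con 0 := x) refl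

  x*0+y*1≈y : ∀ x y → x * 0# + y * 1# ≈ y
  x*0+y*1≈y = solve 2 (λ x y → x :* con 0 :+ y :* con 1 := y) refl

  [r*Y]*z≈r*[Y*z] : ∀ r₁ r₂ a b c d z₁ z₂ →
    (r₁ * a + r₂ * c) * z₁ + (r₁ * b + r₂ * d) * z₂ ≈ r₁ * (a * z₁ + b * z₂) + r₂ * (c * z₁ + d * z₂)
  [r*Y]*z≈r*[Y*z] = solve 8 (λ r₁ r₂ a b c d z₁ z₂ →
    (r₁ :* a :+ r₂ :* c) :* z₁ :+ (r₁ :* b :+ r₂ :* d) :* z₂
      := r₁ :* (a :* z₁ :+ b :* z₂) :+ r₂ :* (c :* z₁ :+ d :* z₂)) refl

  -- The first column (A, C) of the left inverse [[A, B], [C, D]] of [[a, b], [c, d]] is (d, −c) times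
  -- its determinant; the proof moves the terms of that identity to both sides to stay subtraction-free.
  inverse-column-annihilates : ∀ A B C D a b c d →
    A * a + B * c ≈ 1# → A * b + B * d ≈ 0# → C * a + D * c ≈ 0# → C * b + D * d ≈ 1# →
    ∀ s t → c * t ≈ d * s → s * A + t * C ≈ 0#
  inverse-column-annihilates A B C D a b c d e₁₁ e₁₂ e₂₁ e₂₂ s t ct≈ds =
    identityˡ-unique (s * A + t * C) (W * (B * C) + W * (A * D)) (begin
      s * A + t * C + (W * (B * C) + W * (A * D))
        ≈⟨ +-cong (+-cong (*-congˡ (*-identityʳ A)) (*-congˡ (*-identityʳ C))) (+-congˡ (*-congʳ ct≈ds)) ⟨
      s * (A * 1#) + t * (C * 1#) + (W * (B * C) + c * t * (A * D))
        ≈⟨ +-congʳ (+-cong (*-congˡ (*-congˡ e₂₂)) (*-congˡ (*-congˡ e₁₁))) ⟨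
      s * (A * (C * b + D * d)) + t * (C * (A * a + B * c)) + (W * (B * C) + c * t * (A * D))
        ≈⟨ solve 10 (λ A B C D a b c d s t →
             s :* (A :* (C :* b :+ D :* d)) :+ t :* (C :* (A :* a :+ B :* c)) :+ (d :* s :* (B :* C) :+ c :* t :* (A :* D))
               := d :* s :* (A :* D) :+ c :* t :* (B :* C) :+ (s :* (C :* (A :* b :+ B :* d)) :+ t :* (A :* (C :* a :+ D :* c))))
             refl A B C D a b c d s t ⟩
      W * (A * D) + c * t * (B * C) + (s * (C * (A * b + B * d)) + t * (A * (C * a + D * c)))
        ≈⟨ +-cong (+-congˡ (*-congʳ ct≈ds)) (+-cong (*-congˡ (*-congˡ e₁₂)) (*-congˡ (*-congˡ e₂₁))) ⟩
      W * (A * D) + W * (B * C) + (s * (C * 0#) + t * (A * 0#))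
        ≈⟨ solve 7 (λ W x y s t C A → W :* x :+ W :* y :+ (s :* (C :* con 0) :+ t :* (A :* con 0)) := W :* y :+ W :* x)
             refl W (A * D) (B * C) s t C A ⟩
      W * (B * C) + W * (A * D) ∎)
    where
    W = d * s

open import Defs
open import Algebra.Definitions using (Congruent₂)
open import Algebra.Structures using (IsCommutativeRing)
open import Data.Nat
  using (ℕ; zero; suc; _+_; _*_; _∸_; _^_; _<_; _≤_; _≤′_; ≤′-refl; ≤′-step; _≟_; NonZero; z≤n; s≤s; >-nonZero⁻¹; nonTrivial⇒n>1)
import Data.Nat.Properties as ℕ
open import Data.Nat.DivMod
open import Data.Nat.Divisibility
  using (_∣_; ∣-refl; ∣-trans; ∣-reflexive; n∣m*n; ∣1⇒≡1; m%n≡0⇒n∣m; n∣m⇒m%n≡0)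
open import Data.Nat.Coprimality using (Coprime; coprime-divisor; coprime-Bézout)
open import Data.Nat.GCD using (module Bézout)
open import Data.Nat.Primality using (Prime; prime⇒irreducible; prime⇒nonTrivial)
open import Data.Sum using (inj₁; inj₂)
open import Function.Base using (_∘_)
open import Relation.Binary.Core using (Rel)
open import Relation.Binary.Structures using (IsEquivalence)
open import Relation.Binary.PropositionalEquality as ≡ using (_≡_; _≢_; refl; cong; cong₂; subst; module ≡-Reasoning)
import Relation.Binary.Reasoning.Setoid as SetoidReasoning
open import Relation.Nullary using (¬_; Dec; yes; no; contradiction)

[m%d+n]%d≡[m+n]%d : ∀ m n d .{{_ : NonZero d}} → (m % d + n) % d ≡ (m + n) % d
[m%d+n]%d≡[m+n]%d m n d = begin
  (m % d + n) % d          ≡⟨ %-distribˡ-+ (m % d) n d ⟩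
  (m % d % d + n % d) % d  ≡⟨ cong (λ t → (t + n % d) % d) (m%n%n≡m%n m d) ⟩
  (m % d + n % d) % d      ≡⟨ %-distribˡ-+ m n d ⟨
  (m + n) % d              ∎
  where open ≡-Reasoning

[m+n%d]%d≡[m+n]%d : ∀ m n d .{{_ : NonZero d}} → (m + n % d) % d ≡ (m + n) % d
[m+n%d]%d≡[m+n]%d m n d = begin
  (m + n % d) % d  ≡⟨ cong (_% d) (ℕ.+-comm m (n % d)) ⟩
  (n % d + m) % d  ≡⟨ [m%d+n]%d≡[m+n]%d n m d ⟩
  (n + m) % d      ≡⟨ cong (_% d) (ℕ.+-comm n m) ⟩
  (m + n) % d      ∎
  where open ≡-Reasoning

[m%d*n]%d≡[m*n]%d : ∀ m n d .{{_ : NonZero d}} → (m % d * n) % d ≡ (m * n) % d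
[m%d*n]%d≡[m*n]%d m n d = begin
  (m % d * n) % d            ≡⟨ %-distribˡ-* (m % d) n d ⟩
  (m % d % d * (n % d)) % d  ≡⟨ cong (λ t → (t * (n % d)) % d) (m%n%n≡m%n m d) ⟩
  (m % d * (n % d)) % d      ≡⟨ %-distribˡ-* m n d ⟨
  (m * n) % d                ∎
  where open ≡-Reasoning

[m*n%d]%d≡[m*n]%d : ∀ m n d .{{_ : NonZero d}} → (m * (n % d)) % d ≡ (m * n) % d
[m*n%d]%d≡[m*n]%d m n d = begin
  (m * (n % d)) % d  ≡⟨ cong (_% d) (ℕ.*-comm m (n % d)) ⟩
  (n % d * m) % d    ≡⟨ [m%d*n]%d≡[m*n]%d n m d ⟩
  (n * m) % d        ≡⟨ cong (_% d) (ℕ.*-comm n m) ⟩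
  (m * n) % d        ∎
  where open ≡-Reasoning

m∸1<m : ∀ {m} → 0 < m → m ∸ 1 < m
m∸1<m {suc m} _ = ℕ.n<1+n m

m*n∸1≡n∸1+[m∸1]*n : ∀ m n → 0 < m → 0 < n → m * n ∸ 1 ≡ n ∸ 1 + (m ∸ 1) * n
m*n∸1≡n∸1+[m∸1]*n (suc m) (suc n) _ _ = refl

m^i∣m^j : ∀ m {i j} → i ≤′ j → m ^ i ∣ m ^ j
m^i∣m^j m ≤′-refl = ∣-refl
m^i∣m^j m (≤′-step i≤′j) = ∣-trans (m^i∣m^j m i≤′j) (n∣m*n m)

¬∣⇒coprime-^ : ∀ {p u} → Prime p → ¬ p ∣ u → ∀ k → Coprime u (p ^ k)
¬∣⇒coprime-^ p-prime p∤u zero (_ , i∣1) = ∣1⇒≡1 i∣1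
¬∣⇒coprime-^ {p} {u} p-prime p∤u (suc k) {i} (i∣u , i∣p*p^k) =
  ¬∣⇒coprime-^ p-prime p∤u k (i∣u , coprime-divisor i⊥p i∣p*p^k)
  where
  i⊥p : Coprime i p
  i⊥p (j∣i , j∣p) with prime⇒irreducible p-prime j∣p
  ... | inj₁ j≡1  = j≡1
  ... | inj₂ refl = contradiction (∣-trans j∣i i∣u) p∤u

module _ (p : ℕ) {{_ : NonZero p}} where

  private
    Z : Set
    Z = ℤₚ p

  infixl 6 _+ᶻ_
  infixl 7 _*ᶻ_
  _+ᶻ_ _*ᶻ_ : Z → Z → Z
  _+ᶻ_ = _+ₚ_ p
  _*ᶻ_ = _*ₚ_ p

  -- _≈ₚ_ unfolds to a function type, from which Agda cannot recover x and y; the records below can.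
  infix 4 _≈_
  record _≈_ (x y : Z) : Set where
    constructor pointwise
    field at : _≈ₚ_ p x y
  open _≈_ public

  infix 4 _≈[_]_
  record _≈[_]_ (x : Z) (k : ℕ) (y : Z) : Set where
    constructor same-residue
    field residue : seq x k ≡ seq y k
  open _≈[_]_ public

  infixl 7 _%ₖ_
  _%ₖ_ : ℕ → ℕ → ℕ
  _%ₖ_ = _%ᵖ_ p

  seq%ₖ : ∀ (x : Z) k → seq x k %ₖ k ≡ seq x k
  seq%ₖ x k = m<n⇒m%n≡m {{ℕ.m^n≢0 p k}} (bound x k)

  0%ₖ : ∀ k → 0 %ₖ k ≡ 0
  0%ₖ k = m<n⇒m%n≡m {{ℕ.m^n≢0 p k}} (ℕ.m^n>0 p k)

  -1ᶻ : Z
  -1ᶻ = record { seq = λ k → p ^ k ∸ 1 ; bound = λ k → m∸1<m (ℕ.m^n>0 p k) ; compat = compat-1 }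
    where
    compat-1 : ∀ k → (p ^ suc k ∸ 1) %ₖ k ≡ p ^ k ∸ 1
    compat-1 k = begin
      (p ^ suc k ∸ 1) %ₖ k
        ≡⟨ cong (_%ₖ k) (m*n∸1≡n∸1+[m∸1]*n p (p ^ k) (>-nonZero⁻¹ p) (ℕ.m^n>0 p k)) ⟩
      (p ^ k ∸ 1 + (p ∸ 1) * p ^ k) %ₖ k  ≡⟨ [m+kn]%n≡m%n (p ^ k ∸ 1) (p ∸ 1) (p ^ k) ⟩
      (p ^ k ∸ 1) %ₖ k                    ≡⟨ m<n⇒m%n≡m (m∸1<m (ℕ.m^n>0 p k)) ⟩
      p ^ k ∸ 1                           ∎
      where open ≡-Reasoning
            instance _ = ℕ.m^n≢0 p k

  infix 8 -ᶻ_
  -ᶻ_ : Z → Z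
  -ᶻ x = -1ᶻ *ᶻ x

  private
    infix 4 _≐_
    _≐_ : Z → Z → Set
    _≐_ = _≈ₚ_ p

  +ᶻ-assoc : ∀ x y z → (x +ᶻ y) +ᶻ z ≐ x +ᶻ (y +ᶻ z)
  +ᶻ-assoc x y z k = begin
    ((xₖ + yₖ) %ₖ k + zₖ) %ₖ k  ≡⟨ [m%d+n]%d≡[m+n]%d (xₖ + yₖ) zₖ (p ^ k) ⟩
    (xₖ + yₖ + zₖ) %ₖ k         ≡⟨ cong (_%ₖ k) (ℕ.+-assoc xₖ yₖ zₖ) ⟩
    (xₖ + (yₖ + zₖ)) %ₖ k       ≡⟨ [m+n%d]%d≡[m+n]%d xₖ (yₖ + zₖ) (p ^ k) ⟨
    (xₖ + (yₖ + zₖ) %ₖ k) %ₖ k  ∎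
    where open ≡-Reasoning
          instance _ = ℕ.m^n≢0 p k
          xₖ = seq x k
          yₖ = seq y k
          zₖ = seq z k

  *ᶻ-assoc : ∀ x y z → (x *ᶻ y) *ᶻ z ≐ x *ᶻ (y *ᶻ z)
  *ᶻ-assoc x y z k = begin
    ((xₖ * yₖ) %ₖ k * zₖ) %ₖ k    ≡⟨ [m%d*n]%d≡[m*n]%d (xₖ * yₖ) zₖ (p ^ k) ⟩
    (xₖ * yₖ * zₖ) %ₖ k           ≡⟨ cong (_%ₖ k) (ℕ.*-assoc xₖ yₖ zₖ) ⟩
    (xₖ * (yₖ * zₖ)) %ₖ k         ≡⟨ [m*n%d]%d≡[m*n]%d xₖ (yₖ * zₖ) (p ^ k) ⟨
    (xₖ * ((yₖ * zₖ) %ₖ k)) %ₖ k  ∎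
    where open ≡-Reasoning
          instance _ = ℕ.m^n≢0 p k
          xₖ = seq x k
          yₖ = seq y k
          zₖ = seq z k

  +ᶻ-comm : ∀ x y → x +ᶻ y ≐ y +ᶻ x
  +ᶻ-comm x y k = cong (_%ₖ k) (ℕ.+-comm (seq x k) (seq y k))

  *ᶻ-comm : ∀ x y → x *ᶻ y ≐ y *ᶻ x
  *ᶻ-comm x y k = cong (_%ₖ k) (ℕ.*-comm (seq x k) (seq y k))

  +ᶻ-identityˡ : ∀ x → 0ₚ p +ᶻ x ≐ x
  +ᶻ-identityˡ x k = ≡.trans (cong (λ t → (t + seq x k) %ₖ k) (0%ₖ k)) (seq%ₖ x k)

  *ᶻ-identityˡ : ∀ x → 1ₚ p *ᶻ x ≐ x
  *ᶻ-identityˡ x k = begin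
    (1 %ₖ k * seq x k) %ₖ k  ≡⟨ [m%d*n]%d≡[m*n]%d 1 (seq x k) (p ^ k) ⟩
    (1 * seq x k) %ₖ k       ≡⟨ cong (_%ₖ k) (ℕ.*-identityˡ (seq x k)) ⟩
    seq x k %ₖ k             ≡⟨ seq%ₖ x k ⟩
    seq x k                  ∎
    where open ≡-Reasoning
          instance _ = ℕ.m^n≢0 p k

  -ᶻ-inverseˡ : ∀ x → -ᶻ x +ᶻ x ≐ 0ₚ p
  -ᶻ-inverseˡ x k = begin
    ((p ^ k ∸ 1) * xₖ %ₖ k + xₖ) %ₖ k  ≡⟨ [m%d+n]%d≡[m+n]%d ((p ^ k ∸ 1) * xₖ) xₖ (p ^ k) ⟩
    ((p ^ k ∸ 1) * xₖ + xₖ) %ₖ k       ≡⟨ cong (λ t → ((p ^ k ∸ 1) * xₖ + t) %ₖ k) (ℕ.*-identityˡ xₖ) ⟨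
    ((p ^ k ∸ 1) * xₖ + 1 * xₖ) %ₖ k   ≡⟨ cong (_%ₖ k) (ℕ.*-distribʳ-+ xₖ (p ^ k ∸ 1) 1) ⟨
    ((p ^ k ∸ 1 + 1) * xₖ) %ₖ k        ≡⟨ cong (λ t → (t * xₖ) %ₖ k) (ℕ.m∸n+n≡m (ℕ.m^n>0 p k)) ⟩
    (p ^ k * xₖ) %ₖ k                  ≡⟨ cong (_%ₖ k) (ℕ.*-comm (p ^ k) xₖ) ⟩
    (xₖ * p ^ k) %ₖ k                  ≡⟨ m*n%n≡0 xₖ (p ^ k) ⟩
    0                                  ≡⟨ 0%ₖ k ⟨
    0 %ₖ k                             ∎
    where open ≡-Reasoning
          instance _ = ℕ.m^n≢0 p k
          xₖ = seq x k

  *ᶻ-distribˡ-+ᶻ : ∀ x y z → x *ᶻ (y +ᶻ z) ≐ x *ᶻ y +ᶻ x *ᶻ z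
  *ᶻ-distribˡ-+ᶻ x y z k = begin
    (xₖ * ((yₖ + zₖ) %ₖ k)) %ₖ k            ≡⟨ [m*n%d]%d≡[m*n]%d xₖ (yₖ + zₖ) (p ^ k) ⟩
    (xₖ * (yₖ + zₖ)) %ₖ k                   ≡⟨ cong (_%ₖ k) (ℕ.*-distribˡ-+ xₖ yₖ zₖ) ⟩
    (xₖ * yₖ + xₖ * zₖ) %ₖ k                ≡⟨ [m%d+n]%d≡[m+n]%d (xₖ * yₖ) (xₖ * zₖ) (p ^ k) ⟨
    ((xₖ * yₖ) %ₖ k + xₖ * zₖ) %ₖ k         ≡⟨ [m+n%d]%d≡[m+n]%d ((xₖ * yₖ) %ₖ k) (xₖ * zₖ) (p ^ k) ⟨
    ((xₖ * yₖ) %ₖ k + (xₖ * zₖ) %ₖ k) %ₖ k  ∎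
    where open ≡-Reasoning
          instance _ = ℕ.m^n≢0 p k
          xₖ = seq x k
          yₖ = seq y k
          zₖ = seq z k

  module _ {ℓ} (_∼_ : Rel Z ℓ) (isEquivalence : IsEquivalence _∼_)
           (+ᶻ-cong : Congruent₂ _∼_ _+ᶻ_) (*ᶻ-cong : Congruent₂ _∼_ _*ᶻ_)
           (≐⇒∼ : ∀ {x y} → x ≐ y → _∼_ x y) where

    isCommutativeRing-by-residues : IsCommutativeRing _∼_ _+ᶻ_ _*ᶻ_ -ᶻ_ (0ₚ p) (1ₚ p)
    isCommutativeRing-by-residues = record
      { isRing = record
        { +-isAbelianGroup = record
          { isGroup = record
            { isMonoid = record
              { isSemigroup = record
                { isMagma = record { isEquivalence = isEquivalence ; ∙-cong = +ᶻ-cong }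
                ; assoc = λ x y z → ≐⇒∼ (+ᶻ-assoc x y z) }
              ; identity = (λ x → ≐⇒∼ (+ᶻ-identityˡ x))
                         , (λ x → ≐⇒∼ (λ k → ≡.trans (+ᶻ-comm x (0ₚ p) k) (+ᶻ-identityˡ x k))) }
            ; inverse = (λ x → ≐⇒∼ (-ᶻ-inverseˡ x))
                      , (λ x → ≐⇒∼ (λ k → ≡.trans (+ᶻ-comm x (-ᶻ x) k) (-ᶻ-inverseˡ x k)))
            ; ⁻¹-cong = λ {x} {y} → *ᶻ-cong { -1ᶻ} { -1ᶻ} {x} {y} (≐⇒∼ (λ k → refl)) }
          ; comm = λ x y → ≐⇒∼ (+ᶻ-comm x y) }
        ; *-cong = *ᶻ-cong
        ; *-assoc = λ x y z → ≐⇒∼ (*ᶻ-assoc x y z)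
        ; *-identity = (λ x → ≐⇒∼ (*ᶻ-identityˡ x))
                     , (λ x → ≐⇒∼ (λ k → ≡.trans (*ᶻ-comm x (1ₚ p) k) (*ᶻ-identityˡ x k)))
        ; distrib = (λ x y z → ≐⇒∼ (*ᶻ-distribˡ-+ᶻ x y z))
                  , (λ x y z → ≐⇒∼ (λ k → ≡.trans (*ᶻ-comm (y +ᶻ z) x k)
                      (≡.trans (*ᶻ-distribˡ-+ᶻ x y z k)
                        (cong₂ (λ a b → (a + b) %ₖ k) (*ᶻ-comm x y k) (*ᶻ-comm x z k))))) }
      ; *-comm = λ x y → ≐⇒∼ (*ᶻ-comm x y) }

  ℤₚ-commutativeRing : CommutativeRing 0ℓ 0ℓ
  ℤₚ-commutativeRing = record
    { isCommutativeRing = isCommutativeRing-by-residues _≈_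
        (record { refl = pointwise (λ k → refl) ; sym = λ (pointwise e) → pointwise (λ k → ≡.sym (e k))
                ; trans = λ (pointwise e) (pointwise f) → pointwise (λ k → ≡.trans (e k) (f k)) })
        (λ (pointwise e) (pointwise f) → pointwise (λ k → cong₂ (λ a b → (a + b) %ₖ k) (e k) (f k)))
        (λ (pointwise e) (pointwise f) → pointwise (λ k → cong₂ (λ a b → (a * b) %ₖ k) (e k) (f k)))
        pointwise }

  -- ℤₚ up to congruence modulo pᵏ, i.e. the quotient ℤₚ/pᵏℤₚ ≅ ℤ/pᵏ presented as a setoid.
  ℤ/pᵏ-commutativeRing : ℕ → CommutativeRing 0ℓ 0ℓ
  ℤ/pᵏ-commutativeRing k = record
    { isCommutativeRing = isCommutativeRing-by-residues (λ x y → x ≈[ k ] y)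
        (record { refl = same-residue refl ; sym = λ (same-residue e) → same-residue (≡.sym e)
                ; trans = λ (same-residue e) (same-residue f) → same-residue (≡.trans e f) })
        (λ (same-residue e) (same-residue f) → same-residue (cong₂ (λ a b → (a + b) %ₖ k) e f))
        (λ (same-residue e) (same-residue f) → same-residue (cong₂ (λ a b → (a * b) %ₖ k) e f))
        (λ e → same-residue (e k)) }

  module ℤₚ-Ring where
    open CommutativeRing ℤₚ-commutativeRing public
    open CommutativeRingProperties ℤₚ-commutativeRing public

  module ℤ/pᵏ-Ring (k : ℕ) where
    open CommutativeRing (ℤ/pᵏ-commutativeRing k) public
    open CommutativeRingProperties (ℤ/pᵏ-commutativeRing k) public

  module ≈-Reasoning = SetoidReasoning ℤₚ-Ring.setoid
  module ≈[]-Reasoning (k : ℕ) = SetoidReasoning (ℤ/pᵏ-Ring.setoid k)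

  ι : ℕ → Z
  ι = fromℕₚ p

  seq-at-0 : ∀ (x : Z) → seq x 0 ≡ 0
  seq-at-0 x = ℕ.n<1⇒n≡0 (bound x 0)

  residue-reduce : ∀ (x : Z) {j k} → j ≤ k → seq x k %ₖ j ≡ seq x j
  residue-reduce x j≤k = go (ℕ.≤⇒≤′ j≤k)
    where
    go : ∀ {j k} → j ≤′ k → seq x k %ₖ j ≡ seq x j
    go {j} ≤′-refl = seq%ₖ x j
    go {j} (≤′-step {k} j≤′k) = begin
      seq x (suc k) %ₖ j       ≡⟨ m∣n⇒o%n%m≡o%m (p ^ j) (p ^ k) (seq x (suc k)) (m^i∣m^j p j≤′k) ⟨
      seq x (suc k) %ₖ k %ₖ j  ≡⟨ cong (_%ₖ j) (compat x k) ⟩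
      seq x k %ₖ j             ≡⟨ go j≤′k ⟩
      seq x j                  ∎
      where open ≡-Reasoning
            instance _ = ℕ.m^n≢0 p j
                     _ = ℕ.m^n≢0 p k

  ≈[]-weaken : ∀ {x y j k} → j ≤ k → x ≈[ k ] y → x ≈[ j ] y
  ≈[]-weaken {x} {y} {j} {k} j≤k (same-residue e) = same-residue (begin
    seq x j       ≡⟨ residue-reduce x j≤k ⟨
    seq x k %ₖ j  ≡⟨ cong (_%ₖ j) e ⟩
    seq y k %ₖ j  ≡⟨ residue-reduce y j≤k ⟩
    seq y j       ∎)
    where open ≡-Reasoning

  ≈⇒≈[] : ∀ {x y} k → x ≈ y → x ≈[ k ] y
  ≈⇒≈[] k (pointwise e) = same-residue (e k)

  ≈[]0⇒seq≡0 : ∀ {x} k → x ≈[ k ] 0ₚ p → seq x k ≡ 0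
  ≈[]0⇒seq≡0 k (same-residue e) = ≡.trans e (0%ₖ k)

  seq≡0⇒≈[]0 : ∀ x k → seq x k ≡ 0 → x ≈[ k ] 0ₚ p
  seq≡0⇒≈[]0 x k e = same-residue (≡.trans e (≡.sym (0%ₖ k)))

  ι-+ : ∀ m n → ι (m + n) ≈ ι m +ᶻ ι n
  ι-+ m n = pointwise (λ k → %-distribˡ-+ m n (p ^ k) {{ℕ.m^n≢0 p k}})

  ι-* : ∀ m n → ι (m * n) ≈ ι m *ᶻ ι n
  ι-* m n = pointwise (λ k → %-distribˡ-* m n (p ^ k) {{ℕ.m^n≢0 p k}})

  p^k∣⇒ι≈[]0 : ∀ {k m} → p ^ k ∣ m → ι m ≈[ k ] 0ₚ p
  p^k∣⇒ι≈[]0 {k} {m} p^k∣m = seq≡0⇒≈[]0 (ι m) k (n∣m⇒m%n≡0 m (p ^ k) {{ℕ.m^n≢0 p k}} p^k∣m)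

  p^n*y≈[]0 : ∀ {k n} y → k ≤ n → ι (p ^ n) *ᶻ y ≈[ k ] 0ₚ p
  p^n*y≈[]0 {k} {n} y k≤n = begin
    ι (p ^ n) *ᶻ y  ≈⟨ ℤ/pᵏ-Ring.*-congʳ k {y} (p^k∣⇒ι≈[]0 (m^i∣m^j p (ℕ.≤⇒≤′ k≤n))) ⟩
    0ₚ p *ᶻ y       ≈⟨ ℤ/pᵏ-Ring.zeroˡ k y ⟩
    0ₚ p            ∎
    where open ≈[]-Reasoning k

  -- The cofactor y is read off the residues of z at the levels k + n.
  ≈[]0⇒p^n∣ : ∀ {z} n → z ≈[ n ] 0ₚ p → Σ Z (λ y → z ≈ ι (p ^ n) *ᶻ y)
  ≈[]0⇒p^n∣ {z} n z≈0 = y , pointwise z≈p^n*y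
    where
    N : ℕ
    N = p ^ n
    instance N≢0 = ℕ.m^n≢0 p n
    zₙ₊ : ℕ → ℕ
    zₙ₊ k = seq z (k + n)
    N∣zₙ₊ : ∀ k → N ∣ zₙ₊ k
    N∣zₙ₊ k = m%n≡0⇒n∣m (zₙ₊ k) N (≡.trans (residue-reduce z (ℕ.m≤n+m n k)) (≈[]0⇒seq≡0 n z≈0))
    yₖ : ℕ → ℕ
    yₖ k = zₙ₊ k / N
    yₖ*N≡zₙ₊ : ∀ k → yₖ k * N ≡ zₙ₊ k
    yₖ*N≡zₙ₊ k = m/n*n≡m (N∣zₙ₊ k)
    p^[k+n]≡p^k*N : ∀ k → p ^ (k + n) ≡ p ^ k * N
    p^[k+n]≡p^k*N k = ℕ.^-distribˡ-+-* p k n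
    yₖ-compat : ∀ k → yₖ (suc k) %ₖ k ≡ yₖ k
    yₖ-compat k = ℕ.*-cancelʳ-≡ (yₖ (suc k) %ₖ k) (yₖ k) N (begin
      yₖ (suc k) %ₖ k * N           ≡⟨ m%n*o≡m*o%[n*o] (yₖ (suc k)) (p ^ k) N ⟩
      yₖ (suc k) * N % (p ^ k * N)  ≡⟨ cong (_% (p ^ k * N)) (yₖ*N≡zₙ₊ (suc k)) ⟩
      zₙ₊ (suc k) % (p ^ k * N)     ≡⟨ %-congʳ (p^[k+n]≡p^k*N k) ⟨
      zₙ₊ (suc k) %ₖ (k + n)        ≡⟨ compat z (k + n) ⟩
      zₙ₊ k                         ≡⟨ yₖ*N≡zₙ₊ k ⟨
      yₖ k * N                      ∎)
      where open ≡-Reasoning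
            instance _ = ℕ.m^n≢0 p k
                     _ = ℕ.m^n≢0 p (k + n)
                     _ = ℕ.m*n≢0 (p ^ k) N {{ℕ.m^n≢0 p k}}
    y : Z
    y = record
      { seq = yₖ
      ; bound = λ k → m<n*o⇒m/o<n (subst (zₙ₊ k <_) (p^[k+n]≡p^k*N k) (bound z (k + n)))
      ; compat = yₖ-compat }
    z≈p^n*y : ∀ k → seq z k ≡ seq (ι N *ᶻ y) k
    z≈p^n*y k = ≡.sym (begin
      (N %ₖ k * yₖ k) %ₖ k  ≡⟨ [m%d*n]%d≡[m*n]%d N (yₖ k) (p ^ k) ⟩
      (N * yₖ k) %ₖ k       ≡⟨ cong (_%ₖ k) (≡.trans (ℕ.*-comm N (yₖ k)) (yₖ*N≡zₙ₊ k)) ⟩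
      zₙ₊ k %ₖ k            ≡⟨ residue-reduce z (ℕ.m≤m+n k n) ⟩
      seq z k               ∎)
      where open ≡-Reasoning
            instance _ = ℕ.m^n≢0 p k

  minVal≤ : ∀ n x → minVal p n x ≤ n
  minVal≤ zero x = z≤n
  minVal≤ (suc n) x with seq x (suc n) ≟ 0
  ... | yes _ = ℕ.≤-refl
  ... | no _  = ℕ.m≤n⇒m≤1+n (minVal≤ n x)

  minVal-residue : ∀ n x → x ≈[ minVal p n x ] 0ₚ p
  minVal-residue n x = seq≡0⇒≈[]0 x (minVal p n x) (go n)
    where
    go : ∀ n → seq x (minVal p n x) ≡ 0
    go zero = seq-at-0 x
    go (suc n) with seq x (suc n) ≟ 0
    ... | yes x≡0 = x≡0
    ... | no _    = go n

  minVal-maximal : ∀ n x → minVal p n x < n → ¬ x ≈[ suc (minVal p n x) ] 0ₚ p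
  minVal-maximal n x m<n = go n m<n ∘ ≈[]0⇒seq≡0 (suc (minVal p n x))
    where
    go : ∀ n → minVal p n x < n → seq x (suc (minVal p n x)) ≢ 0
    go (suc n) m<n with seq x (suc n) ≟ 0
    ... | yes _ = contradiction m<n (ℕ.<-irrefl refl)
    ... | no x≢0 with ℕ.m≤n⇒m<n∨m≡n (minVal≤ n x)
    ...   | inj₁ m<n′ = go n m<n′
    ...   | inj₂ m≡n  = subst (λ m → seq x (suc m) ≢ 0) (≡.sym m≡n) x≢0

  minVal-cong : ∀ n {x y} → (∀ {k} → k ≤ n → x ≈[ k ] 0ₚ p ⇔ y ≈[ k ] 0ₚ p) → minVal p n x ≡ minVal p n y
  minVal-cong zero x⇔y = refl
  minVal-cong (suc n) {x} {y} x⇔y with seq x (suc n) ≟ 0 | seq y (suc n) ≟ 0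
  ... | yes _   | yes _   = refl
  ... | yes x≡0 | no y≢0  =
    contradiction (≈[]0⇒seq≡0 (suc n) (Equivalence.to (x⇔y ℕ.≤-refl) (seq≡0⇒≈[]0 x (suc n) x≡0))) y≢0
  ... | no x≢0  | yes y≡0 =
    contradiction (≈[]0⇒seq≡0 (suc n) (Equivalence.from (x⇔y ℕ.≤-refl) (seq≡0⇒≈[]0 y (suc n) y≡0))) x≢0
  ... | no _    | no _    = minVal-cong n (λ k≤n → x⇔y (ℕ.m≤n⇒m≤1+n k≤n))

  coprime⇒invertible-mod-p^k : ∀ u k → Coprime u (p ^ k) → Σ Z (λ w → ι u *ᶻ w ≈[ k ] 1ₚ p)
  coprime⇒invertible-mod-p^k u k u⊥p^k with coprime-Bézout u⊥p^k
  ... | Bézout.+- x y 1+y*p^k≡x*u = ι x , (begin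
    ι u *ᶻ ι x             ≈⟨ ≈⇒≈[] k (ι-* u x) ⟨
    ι (u * x)              ≡⟨ cong ι (≡.trans (ℕ.*-comm u x) (≡.sym 1+y*p^k≡x*u)) ⟩
    ι (1 + y * p ^ k)      ≈⟨ ≈⇒≈[] k (ι-+ 1 (y * p ^ k)) ⟩
    1ₚ p +ᶻ ι (y * p ^ k)  ≈⟨ ℤ/pᵏ-Ring.+-congˡ k {1ₚ p} (p^k∣⇒ι≈[]0 (n∣m*n y)) ⟩
    1ₚ p +ᶻ 0ₚ p           ≈⟨ ℤ/pᵏ-Ring.+-identityʳ k (1ₚ p) ⟩
    1ₚ p                   ∎)
    where open ≈[]-Reasoning k
  ... | Bézout.-+ x y 1+x*u≡y*p^k = -ᶻ ι x , ℤ/pᵏ-Ring.1+x*u≈0⇒u*-x≈1 k (ι x) (ι u) (begin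
    1ₚ p +ᶻ ι x *ᶻ ι u  ≈⟨ ℤ/pᵏ-Ring.+-congˡ k {1ₚ p} (≈⇒≈[] k (ι-* x u)) ⟨
    1ₚ p +ᶻ ι (x * u)   ≈⟨ ≈⇒≈[] k (ι-+ 1 (x * u)) ⟨
    ι (1 + x * u)       ≡⟨ cong ι 1+x*u≡y*p^k ⟩
    ι (y * p ^ k)       ≈⟨ p^k∣⇒ι≈[]0 (n∣m*n y) ⟩
    0ₚ p                ∎)
    where open ≈[]-Reasoning k

  -- Inverses modulo pᵏ are unique, so a choice of them for every k is automatically compatible.
  invertible-mod-p^k⇒isUnit : ∀ v → (∀ k → Σ Z (λ w → v *ᶻ w ≈[ k ] 1ₚ p)) → ℤₚ-Ring.IsUnit v
  invertible-mod-p^k⇒isUnit v inverse-mod = w , pointwise (λ k → residue (proj₂ (inverse-mod k)))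
    where
    wₖ : ℕ → Z
    wₖ k = proj₁ (inverse-mod k)
    w : Z
    w = record
      { seq = λ k → seq (wₖ k) k
      ; bound = λ k → bound (wₖ k) k
      ; compat = λ k → ≡.trans (compat (wₖ (suc k)) k)
          (residue (ℤ/pᵏ-Ring.inverse-unique k v (wₖ (suc k)) (wₖ k)
                     (≈[]-weaken (ℕ.n≤1+n k) (proj₂ (inverse-mod (suc k)))) (proj₂ (inverse-mod k)))) }

  module _ (p-prime : Prime p) where

    ¬≈[1]0⇒isUnit : ∀ v → ¬ v ≈[ 1 ] 0ₚ p → ℤₚ-Ring.IsUnit v
    ¬≈[1]0⇒isUnit v v≉0 = invertible-mod-p^k⇒isUnit v inverse-mod-p^k
      where
      p∤vₖ₊₁ : ∀ k → ¬ p ∣ seq v (suc k)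
      p∤vₖ₊₁ k p∣vₖ₊₁ = v≉0 (seq≡0⇒≈[]0 v 1 (begin
        seq v 1             ≡⟨ residue-reduce v (s≤s z≤n) ⟨
        seq v (suc k) %ₖ 1  ≡⟨ n∣m⇒m%n≡0 (seq v (suc k)) (p ^ 1) (∣-trans (∣-reflexive (ℕ.*-identityʳ p)) p∣vₖ₊₁) ⟩
        0                   ∎))
        where open ≡-Reasoning
              instance _ = ℕ.m^n≢0 p 1
      -- Modulo pᵏ, v agrees with the natural number seq v (k + 1), which is prime to p.
      inverse-mod-p^k : ∀ k → Σ Z (λ w → v *ᶻ w ≈[ k ] 1ₚ p)
      inverse-mod-p^k k with coprime⇒invertible-mod-p^k (seq v (suc k)) k (¬∣⇒coprime-^ p-prime (p∤vₖ₊₁ k) k)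
      ... | w , vₖ₊₁*w≈1 = w , ℤ/pᵏ-Ring.trans k v*w≈vₖ₊₁*w vₖ₊₁*w≈1
        where
        v*w≈vₖ₊₁*w : v *ᶻ w ≈[ k ] ι (seq v (suc k)) *ᶻ w
        v*w≈vₖ₊₁*w = ℤ/pᵏ-Ring.*-congʳ k {w} {v} {ι (seq v (suc k))} (same-residue (≡.sym (compat v k)))

    1≉[1]0 : ¬ 1ₚ p ≈[ 1 ] 0ₚ p
    1≉[1]0 1≈0 = contradiction (≡.trans (≡.sym 1%p≡1) (≈[]0⇒seq≡0 1 1≈0)) λ ()
      where
      1%p≡1 : 1 %ₖ 1 ≡ 1
      1%p≡1 = m<n⇒m%n≡m {{ℕ.m^n≢0 p 1}}
        (subst (1 <_) (≡.sym (ℕ.*-identityʳ p)) (nonTrivial⇒n>1 p {{prime⇒nonTrivial p-prime}}))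

    invertible-mod-p⇒isUnit : ∀ v w → v *ᶻ w ≈[ 1 ] 1ₚ p → ℤₚ-Ring.IsUnit v
    invertible-mod-p⇒isUnit v w v*w≈1 = ¬≈[1]0⇒isUnit v λ v≈0 → 1≉[1]0 (begin
      1ₚ p       ≈⟨ v*w≈1 ⟨
      v *ᶻ w     ≈⟨ ℤ/pᵏ-Ring.*-congʳ 1 {w} v≈0 ⟩
      0ₚ p *ᶻ w  ≈⟨ ℤ/pᵏ-Ring.zeroˡ 1 w ⟩
      0ₚ p       ∎)
      where open ≈[]-Reasoning 1

  infixl 7 _∙_
  _∙_ : M2 p → M2 p → M2 p
  _∙_ = _·_ p

  I : M2 p
  I = I₂ p

  infix 4 _≋_
  record _≋_ (X Y : M2 p) : Set where
    constructor entrywise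
    field
      a≈ : a X ≈ a Y
      b≈ : b X ≈ b Y
      c≈ : c X ≈ c Y
      d≈ : d X ≈ d Y
  open _≋_ public

  ≋⇒≈M : ∀ {X Y} → X ≋ Y → _≈M_ p X Y
  ≋⇒≈M (entrywise a≈ b≈ c≈ d≈) = at a≈ , at b≈ , at c≈ , at d≈

  ≈M⇒≋ : ∀ X Y → _≈M_ p X Y → X ≋ Y
  ≈M⇒≋ X Y (a≈ , b≈ , c≈ , d≈) = entrywise (pointwise a≈) (pointwise b≈) (pointwise c≈) (pointwise d≈)

  M₂-monoid : Monoid 0ℓ 0ℓ
  M₂-monoid = record
    { _≈_ = _≋_
    ; _∙_ = _∙_
    ; ε = I
    ; isMonoid = record
      { isSemigroup = record
        { isMagma = record
          { isEquivalence = record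
            { refl = entrywise ℤₚ-Ring.refl ℤₚ-Ring.refl ℤₚ-Ring.refl ℤₚ-Ring.refl
            ; sym = λ (entrywise a≈ b≈ c≈ d≈) →
                entrywise (ℤₚ-Ring.sym a≈) (ℤₚ-Ring.sym b≈) (ℤₚ-Ring.sym c≈) (ℤₚ-Ring.sym d≈)
            ; trans = λ (entrywise a≈ b≈ c≈ d≈) (entrywise a≈′ b≈′ c≈′ d≈′) →
                entrywise (ℤₚ-Ring.trans a≈ a≈′) (ℤₚ-Ring.trans b≈ b≈′)
                          (ℤₚ-Ring.trans c≈ c≈′) (ℤₚ-Ring.trans d≈ d≈′) }
          ; ∙-cong = λ (entrywise a≈ b≈ c≈ d≈) (entrywise a≈′ b≈′ c≈′ d≈′) → entrywise
              (entry-cong a≈ b≈ a≈′ c≈′) (entry-cong a≈ b≈ b≈′ d≈′)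
              (entry-cong c≈ d≈ a≈′ c≈′) (entry-cong c≈ d≈ b≈′ d≈′) }
        ; assoc = λ X Y Z → entrywise
            (assoc-entry (a X) (b X) Y (a Z) (c Z)) (assoc-entry (a X) (b X) Y (b Z) (d Z))
            (assoc-entry (c X) (d X) Y (a Z) (c Z)) (assoc-entry (c X) (d X) Y (b Z) (d Z)) }
      ; identity =
          (λ X → entrywise (ℤₚ-Ring.1*x+0*y≈x (a X) (c X)) (ℤₚ-Ring.1*x+0*y≈x (b X) (d X))
                           (ℤₚ-Ring.0*x+1*y≈y (a X) (c X)) (ℤₚ-Ring.0*x+1*y≈y (b X) (d X)))
        , (λ X → entrywise (ℤₚ-Ring.x*1+y*0≈x (a X) (b X)) (ℤₚ-Ring.x*0+y*1≈y (a X) (b X))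
                           (ℤₚ-Ring.x*1+y*0≈x (c X) (d X)) (ℤₚ-Ring.x*0+y*1≈y (c X) (d X))) } }
    where
    entry-cong : ∀ {r₁ r₁′ r₂ r₂′ z₁ z₁′ z₂ z₂′} → r₁ ≈ r₁′ → r₂ ≈ r₂′ → z₁ ≈ z₁′ → z₂ ≈ z₂′ →
                 r₁ *ᶻ z₁ +ᶻ r₂ *ᶻ z₂ ≈ r₁′ *ᶻ z₁′ +ᶻ r₂′ *ᶻ z₂′
    entry-cong r₁≈ r₂≈ z₁≈ z₂≈ = ℤₚ-Ring.+-cong (ℤₚ-Ring.*-cong r₁≈ z₁≈) (ℤₚ-Ring.*-cong r₂≈ z₂≈)
    assoc-entry : ∀ r₁ r₂ Y z₁ z₂ → (r₁ *ᶻ a Y +ᶻ r₂ *ᶻ c Y) *ᶻ z₁ +ᶻ (r₁ *ᶻ b Y +ᶻ r₂ *ᶻ d Y) *ᶻ z₂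
                                    ≈ r₁ *ᶻ (a Y *ᶻ z₁ +ᶻ b Y *ᶻ z₂) +ᶻ r₂ *ᶻ (c Y *ᶻ z₁ +ᶻ d Y *ᶻ z₂)
    assoc-entry r₁ r₂ Y = ℤₚ-Ring.[r*Y]*z≈r*[Y*z] r₁ r₂ (a Y) (b Y) (c Y) (d Y)

  module M₂ = Monoid M₂-monoid
  module ≋-Reasoning = SetoidReasoning M₂.setoid

  Invertible : M2 p → Set
  Invertible X = Σ (M2 p) (λ Y → X ∙ Y ≋ I × Y ∙ X ≋ I)

  isGL2⇒invertible : ∀ X → IsGL2 p X → Invertible X
  isGL2⇒invertible X (Y , XY≈I , YX≈I) = Y , ≈M⇒≋ (X ∙ Y) I XY≈I , ≈M⇒≋ (Y ∙ X) I YX≈I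

  invertible⇒isGL2 : ∀ X → Invertible X → IsGL2 p X
  invertible⇒isGL2 X (Y , XY≋I , YX≋I) = Y , ≋⇒≈M XY≋I , ≋⇒≈M YX≋I

  ∙-cancelʳ : ∀ X Y Z → Y ∙ Z ≋ I → X ∙ Y ∙ Z ≋ X
  ∙-cancelʳ X Y Z YZ≋I = begin
    X ∙ Y ∙ Z    ≈⟨ M₂.assoc X Y Z ⟩
    X ∙ (Y ∙ Z)  ≈⟨ M₂.∙-congˡ {X} YZ≋I ⟩
    X ∙ I        ≈⟨ M₂.identityʳ X ⟩
    X            ∎
    where open ≋-Reasoning

  ∙-invertible : ∀ X Y → Invertible X → Invertible Y → Invertible (X ∙ Y)
  ∙-invertible X Y (X′ , XX′≋I , X′X≋I) (Y′ , YY′≋I , Y′Y≋I) =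
    Y′ ∙ X′ , cancel-middle X Y Y′ X′ YY′≋I XX′≋I , cancel-middle Y′ X′ X Y X′X≋I Y′Y≋I
    where
    cancel-middle : ∀ U V V′ U′ → V ∙ V′ ≋ I → U ∙ U′ ≋ I → U ∙ V ∙ (V′ ∙ U′) ≋ I
    cancel-middle U V V′ U′ VV′≋I UU′≋I = begin
      U ∙ V ∙ (V′ ∙ U′)  ≈⟨ M₂.assoc (U ∙ V) V′ U′ ⟨
      U ∙ V ∙ V′ ∙ U′    ≈⟨ M₂.∙-congʳ {U′} (∙-cancelʳ U V V′ VV′≋I) ⟩
      U ∙ U′             ≈⟨ UU′≋I ⟩
      I                  ∎
      where open ≋-Reasoning

  nmat-inverse : ∀ x y → x +ᶻ y ≈ 0ₚ p → nmat p x ∙ nmat p y ≋ I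
  nmat-inverse x y x+y≈0 = entrywise
    (ℤₚ-Ring.x*1+y*0≈x (1ₚ p) x)
    (ℤₚ-Ring.trans (ℤₚ-Ring.+-cong (ℤₚ-Ring.*-identityˡ y) (ℤₚ-Ring.*-identityʳ x))
                   (ℤₚ-Ring.trans (ℤₚ-Ring.+-comm y x) x+y≈0))
    (ℤₚ-Ring.x*1+y*0≈x (0ₚ p) (1ₚ p))
    (ℤₚ-Ring.0*x+1*y≈y y (1ₚ p))

  nmat-invertible : ∀ x → Invertible (nmat p x)
  nmat-invertible x =
    nmat p (-ᶻ x) , nmat-inverse x (-ᶻ x) (ℤₚ-Ring.-‿inverseʳ x) , nmat-inverse (-ᶻ x) x (ℤₚ-Ring.-‿inverseˡ x)

  lower-triangular-invertible : ∀ s v → ℤₚ-Ring.IsUnit v → Invertible (mat (1ₚ p) (0ₚ p) s v)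
  lower-triangular-invertible s v (w , v*w≈1) = mat (1ₚ p) (0ₚ p) (-ᶻ (s *ᶻ w)) w ,
    entrywise (ℤₚ-Ring.1*x+0*y≈x (1ₚ p) (-ᶻ (s *ᶻ w))) (ℤₚ-Ring.1*x+0*y≈x (0ₚ p) w)
      (begin
        s *ᶻ 1ₚ p +ᶻ v *ᶻ (-ᶻ (s *ᶻ w))  ≈⟨ +-cong (*-identityʳ s) (ℤₚ-Ring.sym (-‿distribʳ-* v (s *ᶻ w))) ⟩
        s +ᶻ -ᶻ (v *ᶻ (s *ᶻ w))          ≈⟨ +-congˡ {s} (-‿cong (x∙yz≈y∙xz v s w)) ⟩
        s +ᶻ -ᶻ (s *ᶻ (v *ᶻ w))          ≈⟨ +-congˡ {s} (-‿cong (*-congˡ {s} v*w≈1)) ⟩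
        s +ᶻ -ᶻ (s *ᶻ 1ₚ p)              ≈⟨ +-congˡ {s} (-‿cong (*-identityʳ s)) ⟩
        s +ᶻ -ᶻ s                        ≈⟨ -‿inverseʳ s ⟩
        0ₚ p                             ∎)
      (ℤₚ-Ring.trans (+-congʳ {v *ᶻ w} (zeroʳ s)) (ℤₚ-Ring.trans (+-identityˡ (v *ᶻ w)) v*w≈1)) ,
    entrywise (ℤₚ-Ring.1*x+0*y≈x (1ₚ p) s) (ℤₚ-Ring.1*x+0*y≈x (0ₚ p) v)
      (ℤₚ-Ring.trans (+-cong (*-identityʳ (-ᶻ (s *ᶻ w))) (*-comm w s)) (-‿inverseˡ (s *ᶻ w)))
      (ℤₚ-Ring.trans (+-cong (zeroʳ (-ᶻ (s *ᶻ w))) (*-comm w v)) (ℤₚ-Ring.trans (+-identityˡ (v *ᶻ w)) v*w≈1))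
    where
    open ℤₚ-Ring using (+-cong; +-congˡ; +-congʳ; *-congˡ; -‿cong; *-comm; zeroʳ; *-identityʳ; +-identityˡ;
                        -‿inverseˡ; -‿inverseʳ; ring; *-commutativeSemigroup)
    open import Algebra.Properties.Ring ring using (-‿distribʳ-*)
    open import Algebra.Properties.CommutativeSemigroup *-commutativeSemigroup using (x∙yz≈y∙xz)
    open ≈-Reasoning

  c[X∙nmat]≈c : ∀ X x → c (X ∙ nmat p x) ≈ c X
  c[X∙nmat]≈c X x = ℤₚ-Ring.x*1+y*0≈x (c X) (d X)

  minVal-doubleCoset-invariant : ∀ n τ τ′ → InDoubleCoset p n τ τ′ → minVal p n (c τ′) ≡ minVal p n (c τ)
  minVal-doubleCoset-invariant n τ τ′ (κ , ((κ′ , κκ′≈I , _) , y , cκ≈p^n*y) , x , τ′≈κτn) =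
    minVal-cong n (λ {k} → c-vanishes-together k)
    where
    c-vanishes-together : ∀ k → k ≤ n → c τ′ ≈[ k ] 0ₚ p ⇔ c τ ≈[ k ] 0ₚ p
    c-vanishes-together k k≤n = mk⇔
      (λ cτ′≈0 → ℤ/pᵏ-Ring.isUnit*x≈0⇒x≈0 k (d κ) (c τ) dκ-isUnit
                   (trans (sym cτ′≈dκ*cτ) cτ′≈0))
      (λ cτ≈0 → begin
        c τ′         ≈⟨ cτ′≈dκ*cτ ⟩
        d κ *ᶻ c τ   ≈⟨ *-congˡ {d κ} cτ≈0 ⟩
        d κ *ᶻ 0ₚ p  ≈⟨ zeroʳ (d κ) ⟩
        0ₚ p         ∎)
      where
      open ℤ/pᵏ-Ring k using (sym; trans; +-congʳ; *-congˡ; *-congʳ; zeroˡ; zeroʳ; +-identityˡ)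
      open ≈[]-Reasoning k
      cκ≈0 : c κ ≈[ k ] 0ₚ p
      cκ≈0 = trans (≈⇒≈[] k (pointwise cκ≈p^n*y)) (p^n*y≈[]0 y k≤n)
      cτ′≈dκ*cτ : c τ′ ≈[ k ] d κ *ᶻ c τ
      cτ′≈dκ*cτ = begin
        c τ′                        ≈⟨ ≈⇒≈[] k (c≈ (≈M⇒≋ τ′ (κ ∙ τ ∙ nmat p x) τ′≈κτn)) ⟩
        c (κ ∙ τ ∙ nmat p x)        ≈⟨ ≈⇒≈[] k (c[X∙nmat]≈c (κ ∙ τ) x) ⟩
        c κ *ᶻ a τ +ᶻ d κ *ᶻ c τ    ≈⟨ +-congʳ {d κ *ᶻ c τ} (*-congʳ {a τ} cκ≈0) ⟩
        0ₚ p *ᶻ a τ +ᶻ d κ *ᶻ c τ   ≈⟨ +-congʳ {d κ *ᶻ c τ} (zeroˡ (a τ)) ⟩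
        0ₚ p +ᶻ d κ *ᶻ c τ          ≈⟨ +-identityˡ (d κ *ᶻ c τ) ⟩
        d κ *ᶻ c τ                  ∎
      dκ-isUnit : ℤ/pᵏ-Ring.IsUnit k (d κ)
      dκ-isUnit = d κ′ , (begin
        d κ *ᶻ d κ′                  ≈⟨ +-identityˡ (d κ *ᶻ d κ′) ⟨
        0ₚ p +ᶻ d κ *ᶻ d κ′          ≈⟨ +-congʳ {d κ *ᶻ d κ′} (zeroˡ (b κ′)) ⟨
        0ₚ p *ᶻ b κ′ +ᶻ d κ *ᶻ d κ′  ≈⟨ +-congʳ {d κ *ᶻ d κ′} (*-congʳ {b κ′} cκ≈0) ⟨
        c κ *ᶻ b κ′ +ᶻ d κ *ᶻ d κ′   ≈⟨ ≈⇒≈[] k (d≈ (≈M⇒≋ (κ ∙ κ′) I κκ′≈I)) ⟩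
        1ₚ p                         ∎)

  left-inverse-column-annihilates : ∀ k τ h → h ∙ τ ≋ I → ∀ s t →
    c τ *ᶻ t ≈[ k ] d τ *ᶻ s → s *ᶻ a h +ᶻ t *ᶻ c h ≈[ k ] 0ₚ p
  left-inverse-column-annihilates k τ h (entrywise e₁₁ e₁₂ e₂₁ e₂₂) =
    ℤ/pᵏ-Ring.inverse-column-annihilates k (a h) (b h) (c h) (d h) (a τ) (b τ) (c τ) (d τ)
      (≈⇒≈[] k e₁₁) (≈⇒≈[] k e₁₂) (≈⇒≈[] k e₂₁) (≈⇒≈[] k e₂₂)

  record RepresentativeParameters (n : ℕ) (τ : M2 p) (s : Z) : Set where
    field
      v x : Z
      v-isUnit : ℤₚ-Ring.IsUnit v
      c*[s*x+v]≈d*s : c τ *ᶻ (s *ᶻ x +ᶻ v) ≈[ n ] d τ *ᶻ s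

  lower-triangular-∈-doubleCoset : ∀ n τ → Invertible τ → ∀ s → (r : RepresentativeParameters n τ s) →
    InDoubleCoset p n τ (mat (1ₚ p) (0ₚ p) s (RepresentativeParameters.v r))
  lower-triangular-∈-doubleCoset n τ (h , τh≋I , hτ≋I) s r =
    κ , (invertible⇒isGL2 κ κ-invertible , proj₁ p^n∣cκ , at (proj₂ p^n∣cκ)) , -ᶻ x , ≋⇒≈M σ≋κτn
    where
    open RepresentativeParameters r
    σ σn κ : M2 p
    σ = mat (1ₚ p) (0ₚ p) s v
    σn = σ ∙ nmat p x
    κ = σn ∙ h
    κ-invertible : Invertible κ
    κ-invertible = ∙-invertible σn h
      (∙-invertible σ (nmat p x) (lower-triangular-invertible s v v-isUnit) (nmat-invertible x)) (τ , hτ≋I , τh≋I)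
    σ≋κτn : σ ≋ κ ∙ τ ∙ nmat p (-ᶻ x)
    σ≋κτn = M₂.sym (begin
      σn ∙ h ∙ τ ∙ nmat p (-ᶻ x)  ≈⟨ M₂.∙-congʳ {nmat p (-ᶻ x)} (∙-cancelʳ σn h τ hτ≋I) ⟩
      σn ∙ nmat p (-ᶻ x)          ≈⟨ ∙-cancelʳ σ (nmat p x) (nmat p (-ᶻ x)) (proj₁ (proj₂ (nmat-invertible x))) ⟩
      σ                           ∎)
      where open ≋-Reasoning
    cκ≈0 : c κ ≈[ n ] 0ₚ p
    cκ≈0 = left-inverse-column-annihilates n τ h hτ≋I (c σn) (d σn) (begin
      c τ *ᶻ (s *ᶻ x +ᶻ v *ᶻ 1ₚ p)
        ≈⟨ *-congˡ {c τ} (≈⇒≈[] n (ℤₚ-Ring.+-congˡ {s *ᶻ x} (ℤₚ-Ring.*-identityʳ v))) ⟩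
      c τ *ᶻ (s *ᶻ x +ᶻ v)          ≈⟨ c*[s*x+v]≈d*s ⟩
      d τ *ᶻ s                      ≈⟨ *-congˡ {d τ} (≈⇒≈[] n (ℤₚ-Ring.x*1+y*0≈x s v)) ⟨
      d τ *ᶻ (s *ᶻ 1ₚ p +ᶻ v *ᶻ 0ₚ p) ∎)
      where open ℤ/pᵏ-Ring n using (*-congˡ)
            open ≈[]-Reasoning n
    p^n∣cκ : Σ Z (λ y → c κ ≈ ι (p ^ n) *ᶻ y)
    p^n∣cκ = ≈[]0⇒p^n∣ n cκ≈0

  module _ (p-prime : Prime p) where

    minVal<n⇒unit-cofactor : ∀ n x → minVal p n x < n →
      Σ Z (λ y → x ≈ ι (p ^ minVal p n x) *ᶻ y × ℤₚ-Ring.IsUnit y)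
    minVal<n⇒unit-cofactor n x m<n = y , x≈p^m*y , ¬≈[1]0⇒isUnit p-prime y y≉0
      where
      m : ℕ
      m = minVal p n x
      p^m∣x : Σ Z (λ y → x ≈ ι (p ^ m) *ᶻ y)
      p^m∣x = ≈[]0⇒p^n∣ m (minVal-residue n x)
      y : Z
      y = proj₁ p^m∣x
      x≈p^m*y : x ≈ ι (p ^ m) *ᶻ y
      x≈p^m*y = proj₂ p^m∣x
      y≉0 : ¬ y ≈[ 1 ] 0ₚ p
      y≉0 y≈0 = minVal-maximal n x m<n
        (ℤ/pᵏ-Ring.trans (suc m) (≈⇒≈[] (suc m) x≈p^[1+m]*y′) (p^n*y≈[]0 y′ ℕ.≤-refl))
        where
        p∣y : Σ Z (λ y′ → y ≈ ι (p ^ 1) *ᶻ y′)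
        p∣y = ≈[]0⇒p^n∣ 1 y≈0
        y′ : Z
        y′ = proj₁ p∣y
        x≈p^[1+m]*y′ : x ≈ ι (p ^ suc m) *ᶻ y′
        x≈p^[1+m]*y′ = begin
          x                               ≈⟨ x≈p^m*y ⟩
          ι (p ^ m) *ᶻ y                  ≈⟨ ℤₚ-Ring.*-congˡ {ι (p ^ m)} (proj₂ p∣y) ⟩
          ι (p ^ m) *ᶻ (ι (p ^ 1) *ᶻ y′)  ≈⟨ ℤₚ-Ring.*-assoc (ι (p ^ m)) (ι (p ^ 1)) y′ ⟨
          ι (p ^ m) *ᶻ ι (p ^ 1) *ᶻ y′    ≈⟨ ℤₚ-Ring.*-congʳ {y′} (ι-* (p ^ m) (p ^ 1)) ⟨
          ι (p ^ m * p ^ 1) *ᶻ y′         ≡⟨ cong (λ e → ι e *ᶻ y′) (ℕ.^-distribˡ-+-* p m 1) ⟨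
          ι (p ^ (m + 1)) *ᶻ y′           ≡⟨ cong (λ e → ι (p ^ e) *ᶻ y′) (ℕ.+-comm m 1) ⟩
          ι (p ^ suc m) *ᶻ y′             ∎
          where open ≈-Reasoning

    c≈[1]0⇒isUnit-d : ∀ τ → Invertible τ → c τ ≈[ 1 ] 0ₚ p → ℤₚ-Ring.IsUnit (d τ)
    c≈[1]0⇒isUnit-d τ (h , _ , hτ≋I) cτ≈0 = invertible-mod-p⇒isUnit p-prime (d τ) (d h) (begin
      d τ *ᶻ d h                ≈⟨ *-comm (d τ) (d h) ⟩
      d h *ᶻ d τ                ≈⟨ +-identityˡ (d h *ᶻ d τ) ⟨
      0ₚ p +ᶻ d h *ᶻ d τ        ≈⟨ +-congʳ {d h *ᶻ d τ} (trans (*-congʳ {b τ} ch≈0) (zeroˡ (b τ))) ⟨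
      c h *ᶻ b τ +ᶻ d h *ᶻ d τ  ≈⟨ ≈⇒≈[] 1 (d≈ hτ≋I) ⟩
      1ₚ p                      ∎)
      where
      open ℤ/pᵏ-Ring 1 using (sym; trans; +-congʳ; *-congʳ; *-comm; zeroˡ; zeroʳ; *-identityʳ; +-identityˡ)
      open ≈[]-Reasoning 1
      ch≈0 : c h ≈[ 1 ] 0ₚ p
      ch≈0 = begin
        c h                         ≈⟨ ≈⇒≈[] 1 (ℤₚ-Ring.0*x+1*y≈y (a h) (c h)) ⟨
        0ₚ p *ᶻ a h +ᶻ 1ₚ p *ᶻ c h  ≈⟨ left-inverse-column-annihilates 1 τ h hτ≋I (0ₚ p) (1ₚ p)
                                         (trans (*-identityʳ (c τ)) (trans cτ≈0 (sym (zeroʳ (d τ))))) ⟩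
        0ₚ p                        ∎

    representative-parameters : ∀ n τ → Invertible τ → RepresentativeParameters n τ (ι (p ^ cₚ p n τ))
    representative-parameters n τ τ-invertible with ℕ.m≤n⇒m<n∨m≡n (minVal≤ n (c τ))
    ... | inj₂ m≡n = record
      { v = 1ₚ p ; x = 0ₚ p ; v-isUnit = 1ₚ p , ℤₚ-Ring.*-identityʳ (1ₚ p) ; c*[s*x+v]≈d*s = begin
      c τ *ᶻ (P *ᶻ 0ₚ p +ᶻ 1ₚ p)   ≈⟨ *-congʳ {P *ᶻ 0ₚ p +ᶻ 1ₚ p} cτ≈0 ⟩
      0ₚ p *ᶻ (P *ᶻ 0ₚ p +ᶻ 1ₚ p)  ≈⟨ zeroˡ (P *ᶻ 0ₚ p +ᶻ 1ₚ p) ⟩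
      0ₚ p                         ≈⟨ zeroʳ (d τ) ⟨
      d τ *ᶻ 0ₚ p                  ≈⟨ *-congˡ {d τ} P≈0 ⟨
      d τ *ᶻ P                     ∎ }
      where
      open ℤ/pᵏ-Ring n using (*-congˡ; *-congʳ; zeroˡ; zeroʳ)
      open ≈[]-Reasoning n
      P : Z
      P = ι (p ^ cₚ p n τ)
      cτ≈0 : c τ ≈[ n ] 0ₚ p
      cτ≈0 = subst (λ k → c τ ≈[ k ] 0ₚ p) m≡n (minVal-residue n (c τ))
      P≈0 : P ≈[ n ] 0ₚ p
      P≈0 = p^k∣⇒ι≈[]0 (m^i∣m^j p (ℕ.≤⇒≤′ (ℕ.≤-reflexive (≡.sym m≡n))))
    ... | inj₁ m<n = choose (cₚ p n τ ≟ 0)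
      where
      m : ℕ
      m = cₚ p n τ
      P : Z
      P = ι (p ^ m)
      cofactor : Σ Z (λ y → c τ ≈ P *ᶻ y × ℤₚ-Ring.IsUnit y)
      cofactor = minVal<n⇒unit-cofactor n (c τ) m<n
      y y′ t : Z
      y = proj₁ cofactor
      y′ = proj₁ (proj₂ (proj₂ cofactor))
      t = d τ *ᶻ y′
      y*y′≈1 : y *ᶻ y′ ≈ 1ₚ p
      y*y′≈1 = proj₂ (proj₂ (proj₂ cofactor))
      cτ*t≈dτ*P : c τ *ᶻ t ≈ d τ *ᶻ P
      cτ*t≈dτ*P = begin
        c τ *ᶻ (d τ *ᶻ y′)     ≈⟨ *-congʳ {d τ *ᶻ y′} (proj₁ (proj₂ cofactor)) ⟩
        P *ᶻ y *ᶻ (d τ *ᶻ y′)  ≈⟨ interchange P y (d τ) y′ ⟩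
        P *ᶻ d τ *ᶻ (y *ᶻ y′)  ≈⟨ *-cong (*-comm P (d τ)) y*y′≈1 ⟩
        d τ *ᶻ P *ᶻ 1ₚ p       ≈⟨ *-identityʳ (d τ *ᶻ P) ⟩
        d τ *ᶻ P               ∎
        where open ℤₚ-Ring using (*-cong; *-congʳ; *-comm; *-identityʳ; *-commutativeSemigroup)
              open import Algebra.Properties.CommutativeSemigroup *-commutativeSemigroup using (interchange)
              open ≈-Reasoning
      with-t : ∀ v x → ℤₚ-Ring.IsUnit v → P *ᶻ x +ᶻ v ≈ t → RepresentativeParameters n τ P
      with-t v x v-isUnit P*x+v≈t = record
        { v = v ; x = x ; v-isUnit = v-isUnit
        ; c*[s*x+v]≈d*s = ≈⇒≈[] n (ℤₚ-Ring.trans (ℤₚ-Ring.*-congˡ {c τ} P*x+v≈t) cτ*t≈dτ*P) }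
      choose : Dec (m ≡ 0) → RepresentativeParameters n τ P
      choose (yes m≡0) = with-t (1ₚ p) (t +ᶻ -ᶻ 1ₚ p) (1ₚ p , ℤₚ-Ring.*-identityʳ (1ₚ p)) (begin
        P *ᶻ (t +ᶻ -ᶻ 1ₚ p) +ᶻ 1ₚ p     ≈⟨ +-congʳ {1ₚ p} (*-congʳ {t +ᶻ -ᶻ 1ₚ p} P≈1) ⟩
        1ₚ p *ᶻ (t +ᶻ -ᶻ 1ₚ p) +ᶻ 1ₚ p  ≈⟨ +-congʳ {1ₚ p} (*-identityˡ (t +ᶻ -ᶻ 1ₚ p)) ⟩
        t +ᶻ -ᶻ 1ₚ p +ᶻ 1ₚ p            ≈⟨ +-assoc t (-ᶻ 1ₚ p) (1ₚ p) ⟩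
        t +ᶻ (-ᶻ 1ₚ p +ᶻ 1ₚ p)          ≈⟨ +-congˡ {t} (-‿inverseˡ (1ₚ p)) ⟩
        t +ᶻ 0ₚ p                       ≈⟨ +-identityʳ t ⟩
        t                               ∎)
        where
        open ℤₚ-Ring using (+-congˡ; +-congʳ; *-congʳ; +-assoc; *-identityˡ; -‿inverseˡ; +-identityʳ)
        open ≈-Reasoning
        P≈1 : P ≈ 1ₚ p
        P≈1 = pointwise (λ k → cong (λ e → p ^ e %ₖ k) m≡0)
      choose (no m≢0) = with-t t (0ₚ p) (ℤₚ-Ring.*-isUnit (d τ) y′ dτ-isUnit y′-isUnit)
        (ℤₚ-Ring.trans (ℤₚ-Ring.+-congʳ {t} (ℤₚ-Ring.zeroʳ P)) (ℤₚ-Ring.+-identityˡ t))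
        where
        dτ-isUnit : ℤₚ-Ring.IsUnit (d τ)
        dτ-isUnit = c≈[1]0⇒isUnit-d τ τ-invertible (≈[]-weaken (ℕ.n≢0⇒n>0 m≢0) (minVal-residue n (c τ)))
        y′-isUnit : ℤₚ-Ring.IsUnit y′
        y′-isUnit = y , ℤₚ-Ring.trans (ℤₚ-Ring.*-comm y′ y) y*y′≈1

lemma2p3 : (p : ℕ) {{_ : NonZero p}} → Prime p → (n : ℕ) → (τ : M2 p) → IsGL2 p τ →
    ((τ' : M2 p) → IsGL2 p τ' → InDoubleCoset p n τ τ' →
      (cₚ p n τ' ≡ cₚ p n τ) × (wₚ p n τ' ≡ wₚ p n τ))
    × Σ (ℤₚ p) (λ v → IsUnitₚ p v ×
        InDoubleCoset p n τ (mat (1ₚ p) (0ₚ p) (fromℕₚ p (p ^ cₚ p n τ)) v))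
lemma2p3 p p-prime n τ τ∈GL₂ =
  invariance , v , (proj₁ v-isUnit , at (proj₂ v-isUnit)) ,
  lower-triangular-∈-doubleCoset p n τ τ-invertible P parameters
  where
  invariance : (τ′ : M2 p) → IsGL2 p τ′ → InDoubleCoset p n τ τ′ →
               (cₚ p n τ′ ≡ cₚ p n τ) × (wₚ p n τ′ ≡ wₚ p n τ)
  invariance τ′ _ τ′∈K₀τN = cₚ-invariant , cong (λ m → n ∸ 2 * m) cₚ-invariant
    where
    cₚ-invariant : cₚ p n τ′ ≡ cₚ p n τ
    cₚ-invariant = minVal-doubleCoset-invariant p n τ τ′ τ′∈K₀τN
  τ-invertible : Invertible p τ
  τ-invertible = isGL2⇒invertible p τ τ∈GL₂
  P : ℤₚ p
  P = fromℕₚ p (p ^ cₚ p n τ)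
  parameters : RepresentativeParameters p n τ P
  parameters = representative-parameters p p-prime n τ τ-invertible
  open RepresentativeParameters parameters using (v; v-isUnit)
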